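{- For integers $m_1,\dots,m_r,n_1,\dots,n_r\ge1$ with $n_1+\cdots+n_r=m_1+\cdots+m_r$, \[ e\tbinom{m_1,\dots,m_r}{n_1,\dots,n_r}=\delta\tbinom{m_1,\dots,m_r}{n_1,\dots,n_r}+\sum_{i=1}^{r-1}\delta\tbinom{m_2,\dots,m_i,m_{i+2},\dots,m_r}{n_1,\dots,n_{i-1},n_{i+2},\dots,n_r}\,b^{m_1}_{n_i,n_{i+1}}, \] where $b^{m}_{n,n'}=(-1)^n\binom{m-1}{n-1}+(-1)^{n'-m}\binom{m-1}{n'-1}$.
   Context: For $m\ge1$ and $g\in\mathbb Q[x_1,\dots,x_s]$ define $x_1^{m-1}\,\underline{\circ}\, g=\sum_{i=0}^{s}(x_{i+1}-x_i)^{m-1}g(x_1,\dots,\widehat{x_{i+1}},\dots,x_{s+1})+(-1)^{m}\sum_{i=1}^{s}(x_i-x_{i+1})^{m-1}g(x_1,\dots,\widehat{x_i},\dots,x_{s+1})$ with $x_0=0$ (hat = omitted variable). For positive integers with $\sum n_i=\sum m_i$, $e\binom{m_1,\dots,m_r}{n_1,\dots,n_r}$ is the coefficient of $x_1^{n_1-1}\cdots x_r^{n_r-1}$ in $x_1^{m_1-1}\,\underline{\circ}\,(x_1^{m_2-1}\cdots x_{r-1}^{m_r-1})$, and $e\binom{m_1}{n_1}=\delta\binom{m_1}{n_1}$. $\delta\binom{a_1,\dots,a_k}{b_1,\dots,b_k}$ is $1$ if $a_j=b_j$ for all $j$ and $0$ otherwise (equal to $1$ for empty tuples). -}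

module Defs where

open import Data.Nat as ℕ using (ℕ; zero; suc; _∸_)
open import Data.Nat.Combinatorics using (_C_)
open import Data.Integer as ℤ using (ℤ; +_; _+_; _*_; -_; ∣_∣)
open import Data.Fin as Fin using (Fin; zero; suc; inject₁; punchIn; _≟_)
open import Data.Vec as Vec using (Vec; []; _∷_; tabulate; zipWith; replicate; lookup)
import Data.Vec.Properties as VecP
open import Data.List as List using (List; []; _∷_; _++_; map; concatMap; foldr; allFin; take; drop)
import Data.List.Properties as ListP
open import Data.Product using (_×_; _,_)
open import Relation.Nullary using (yes; no)
open import Data.Bool using (if_then_else_)
open import Relation.Nullary.Decidable using (⌊_⌋)

-- Polynomials with integer coefficients in n variables x_1..x_n
-- (variable x_{j+1} is indexed by j : Fin n), represented as a formal
-- (unnormalised) sum of monomials c · x^e.  Only coefficient extraction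
-- is ever observed, so no normalisation is needed.

Poly : ℕ → Set
Poly n = List (ℤ × Vec ℕ n)

ℤsum : List ℤ → ℤ
ℤsum = foldr _+_ (+ 0)

zeroP : ∀ {n} → Poly n
zeroP = []

oneP : ∀ {n} → Poly n
oneP = (+ 1 , replicate _ 0) ∷ []

var : ∀ {n} → Fin n → Poly n
var i = (+ 1 , tabulate (λ j → if ⌊ i ≟ j ⌋ then 1 else 0)) ∷ []

_⊕_ : ∀ {n} → Poly n → Poly n → Poly n
p ⊕ q = p ++ q

scaleP : ∀ {n} → ℤ → Poly n → Poly n
scaleP c = map (λ { (a , e) → (c * a , e) })

negP : ∀ {n} → Poly n → Poly n
negP = scaleP (- (+ 1))

_⊖_ : ∀ {n} → Poly n → Poly n → Poly n
p ⊖ q = p ⊕ negP q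

_⊗_ : ∀ {n} → Poly n → Poly n → Poly n
p ⊗ q = concatMap (λ { (a , e) → map (λ { (b , f) → (a * b , zipWith ℕ._+_ e f) }) q }) p

_^P_ : ∀ {n} → Poly n → ℕ → Poly n
p ^P zero = oneP
p ^P suc k = p ⊗ (p ^P k)

prodP : ∀ {n} → List (Poly n) → Poly n
prodP = foldr _⊗_ oneP

sumP : ∀ {n} → List (Poly n) → Poly n
sumP = foldr _⊕_ zeroP

rename : ∀ {s t} → (Fin s → Fin t) → Poly s → Poly t
rename {s} ρ p = sumP (map (λ { (c , e) →
  scaleP c (prodP (map (λ k → var (ρ k) ^P lookup e k) (allFin s))) }) p)

-- g(x_1,...,\hat{x_{j+1}},...,x_{s+1})  (j : Fin (s+1), 0-based)
omit : ∀ {s} → Fin (suc s) → Poly s → Poly (suc s)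
omit j = rename (punchIn j)

coeff : ∀ {n} → Poly n → Vec ℕ n → ℤ
coeff p v = ℤsum (map (λ { (c , e) → if ⌊ VecP.≡-dec ℕ._≟_ e v ⌋ then c else + 0 }) p)

neg1^ : ℕ → ℤ
neg1^ zero = + 1
neg1^ (suc k) = - neg1^ k

neg1^ℤ : ℤ → ℤ
neg1^ℤ z = neg1^ ∣ z ∣

-- The operation x_1^{m-1} ∘ g for g ∈ Poly s (result in Poly (s+1)), x_0 = 0.

-- x_i for the 0-based index i : Fin (s+1) of x_{i+1}, i.e. the "previous" variable
prevVar : ∀ {s} → Fin (suc s) → Poly (suc s)
prevVar zero = zeroP
prevVar (suc j) = var (inject₁ j)

circ : ∀ {s} → ℕ → Poly s → Poly (suc s)
circ {s} m g =
  sumP (map (λ (i : Fin (suc s)) →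
         ((var i ⊖ prevVar i) ^P (m ∸ 1)) ⊗ omit i g) (allFin (suc s)))
  ⊕ scaleP (neg1^ m)
      (sumP (map (λ (j : Fin s) →
         ((var (inject₁ j) ⊖ var (suc j)) ^P (m ∸ 1)) ⊗ omit (inject₁ j) g) (allFin s)))

δ : List ℕ → List ℕ → ℤ
δ a b = if ⌊ ListP.≡-dec ℕ._≟_ a b ⌋ then + 1 else + 0

e : ∀ {k} → Vec ℕ (suc k) → Vec ℕ (suc k) → ℤ
e {zero} (m₁ ∷ []) (n₁ ∷ []) = δ (m₁ ∷ []) (n₁ ∷ [])
e {suc k} (m₁ ∷ ms) ns =
  coeff (circ m₁ ((+ 1 , Vec.map (λ a → a ∸ 1) ms) ∷ []))
        (Vec.map (λ a → a ∸ 1) ns)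

b : ℕ → ℕ → ℕ → ℤ
b m n n′ = neg1^ n * + ((m ∸ 1) C (n ∸ 1))
         + neg1^ℤ (+ n′ ℤ.- + m) * + ((m ∸ 1) C (n′ ∸ 1))

rhs : ∀ {k} → Vec ℕ (suc k) → Vec ℕ (suc k) → ℤ
rhs {k} ms ns =
  δ (Vec.toList ms) (Vec.toList ns)
  + ℤsum (map (λ (j : Fin k) →
      δ (take (Fin.toℕ j) (List.drop 1 (Vec.toList ms)) ++ drop (suc (suc (Fin.toℕ j))) (Vec.toList ms))
        (take (Fin.toℕ j) (Vec.toList ns) ++ drop (suc (suc (Fin.toℕ j))) (Vec.toList ns))
      * b (lookup ms zero) (lookup ns (inject₁ j)) (lookup ns (suc j)))
    (allFin k))

{-# OPTIONS --safe #-}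

-- Put g = x^a with a = (m₂ − 1, …, m_r − 1), M = m₁ − 1 and read off the coefficient of x^v,
-- v = (n₁ − 1, …, n_r − 1), term by term.  The term i = 0 of x₁^M ∘ g is the monomial
-- x₁^M x₂^{a₁}⋯, which gives δ.  For 1 ≤ i < r the i-th terms of the two sums are
-- (x_{i+1} − x_i)^M resp. (−1)^{m₁} (x_i − x_{i+1})^M times x^a with a zero exponent inserted at
-- position i+1 resp. i.  Both contribute only if v with its entries i, i+1 removed equals a with
-- its entry i removed, and then each contribution is a coefficient of x^p y^q (x − y)^M, computed
-- by Pascal's rule by induction on M.  As Σn = Σm forces v_i + v_{i+1} = M + a_i, the two
-- coefficients are exactly the two summands of b^{m₁}_{n_i, n_{i+1}}.

module Submission where

open import Defs
open import Data.Nat using (ℕ; suc; _≤_)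
open import Data.Fin using (Fin)
open import Data.Vec using (Vec; lookup; sum)
open import Relation.Binary.PropositionalEquality using (_≡_)

open import Data.Bool using (Bool; true; false; if_then_else_)
open import Data.Empty using (⊥-elim)
open import Data.Fin as Fin using (zero; suc; inject₁; punchIn; toℕ)
import Data.Fin.Properties as Finₚ
open import Data.Integer as ℤ using (ℤ; +_; -_; _+_; _-_; _*_)
import Data.Integer.Properties as ℤₚ
open import Data.Integer.Solver using (module +-*-Solver)
open import Data.List as List using (List; []; _∷_; _++_; take; drop)
import Data.List.Properties as Listₚ
open import Data.List.Relation.Unary.All using (All; []; _∷_)
import Data.List.Relation.Unary.All.Properties as Allₚ
open import Data.Nat as ℕ using (zero; _∸_; _<_; s≤s; z≤n)
open import Data.Nat.Combinatorics using (_C_; nCn≡1; k>n⇒nCk≡0; nCk+nC[k+1]≡[n+1]C[k+1]; nCk≡nC[n∸k])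
import Data.Nat.ListAction as ℕᴸ
import Data.Nat.Properties as ℕₚ
open import Algebra.Properties.CommutativeSemigroup ℕₚ.+-commutativeSemigroup using (x∙yz≈y∙xz)
open import Data.Product using (_×_; _,_)
open import Data.Sum using (_⊎_; inj₁; inj₂)
open import Data.Vec as Vec using ([]; _∷_; zipWith; tabulate; replicate; insertAt)
import Data.Vec.Properties as Vecₚ
import Data.Vec.Relation.Unary.All.Properties as VecAllₚ
open import Function using (_∘_; _⇔_; mk⇔; Equivalence)
open import Relation.Nullary using (Dec; yes; no; ¬_)
open import Relation.Nullary.Decidable using (⌊_⌋; isYes≗does; does-⇔; ⌊⌋-map′; ¬?; _→-dec_)
open import Relation.Binary.PropositionalEquality using (refl; sym; trans; cong; cong₂; _≢_; module ≡-Reasoning)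

⌊⌋-⇔ : ∀ {P Q : Set} → P ⇔ Q → (p? : Dec P) (q? : Dec Q) → ⌊ p? ⌋ ≡ ⌊ q? ⌋
⌊⌋-⇔ P⇔Q p? q? = trans (isYes≗does p?) (trans (does-⇔ P⇔Q p? q?) (sym (isYes≗does q?)))

⌊⌋-true : ∀ {P : Set} (p? : Dec P) → P → ⌊ p? ⌋ ≡ true
⌊⌋-true (yes _) _ = refl
⌊⌋-true (no ¬p) p = ⊥-elim (¬p p)

⌊⌋-false : ∀ {P : Set} (p? : Dec P) → ¬ P → ⌊ p? ⌋ ≡ false
⌊⌋-false (yes p) ¬p = ⊥-elim (¬p p)
⌊⌋-false (no _) _ = refl

*-if : ∀ t (c a : ℤ) → (if t then c * a else + 0) ≡ c * (if t then a else + 0)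
*-if true c a = refl
*-if false c a = sym (ℤₚ.*-zeroʳ c)

if-− : ∀ t (a b : ℤ) → (if t then a else + 0) - (if t then b else + 0) ≡ (if t then a - b else + 0)
if-− true a b = refl
if-− false a b = refl

lookup-extensionality : ∀ {n} {u v : Vec ℕ n} → (∀ i → lookup u i ≡ lookup v i) → u ≡ v
lookup-extensionality {u = u} {v} u≗v =
  trans (sym (Vecₚ.tabulate∘lookup u)) (trans (Vecₚ.tabulate-cong u≗v) (Vecₚ.tabulate∘lookup v))

toList-injective : ∀ {n} (u v : Vec ℕ n) → Vec.toList u ≡ Vec.toList v → u ≡ v
toList-injective u v eq = trans (sym (Vecₚ.cast-is-id refl u)) (Vecₚ.toList-injective refl u v eq)

-- Coefficients of formal polynomials

infixl 6 _+ᵛ_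

_+ᵛ_ : ∀ {n} → Vec ℕ n → Vec ℕ n → Vec ℕ n
_+ᵛ_ = zipWith ℕ._+_

+ᵛ-identityˡ : ∀ {n} (w : Vec ℕ n) → replicate n 0 +ᵛ w ≡ w
+ᵛ-identityˡ = Vecₚ.zipWith-identityˡ ℕₚ.+-identityˡ

_==ᵛ_ : ∀ {n} → Vec ℕ n → Vec ℕ n → Bool
u ==ᵛ v = ⌊ Vecₚ.≡-dec ℕ._≟_ u v ⌋

monomial : ∀ {n} → Vec ℕ n → Poly n
monomial w = (+ 1 , w) ∷ []

coeff-⊕ : ∀ {n} (p q : Poly n) v → coeff (p ⊕ q) v ≡ coeff p v + coeff q v
coeff-⊕ [] q v = sym (ℤₚ.+-identityˡ _)
coeff-⊕ ((c , f) ∷ p) q v = trans (cong (λ z → x + z) (coeff-⊕ p q v)) (sym (ℤₚ.+-assoc x (coeff p v) (coeff q v)))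
  where x = if f ==ᵛ v then c else + 0

coeff-scaleP : ∀ {n} c (p : Poly n) v → coeff (scaleP c p) v ≡ c * coeff p v
coeff-scaleP c [] v = sym (ℤₚ.*-zeroʳ c)
coeff-scaleP c ((a , f) ∷ p) v =
  trans (cong₂ _+_ (*-if (f ==ᵛ v) c a) (coeff-scaleP c p v)) (sym (ℤₚ.*-distribˡ-+ c _ (coeff p v)))

coeff-sumP-tabulate : ∀ {n m k} (t : Fin k → Fin m) (g : Fin m → Poly n) v →
                      coeff (sumP (List.map g (List.tabulate t))) v ≡ ℤsum (List.tabulate (λ i → coeff (g (t i)) v))
coeff-sumP-tabulate {k = zero} t g v = refl
coeff-sumP-tabulate {k = suc k} t g v =
  trans (coeff-⊕ (g (t zero)) _ v) (cong (λ z → coeff (g (t zero)) v + z) (coeff-sumP-tabulate (t ∘ suc) g v))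

coeff-circ : ∀ {s} m (g : Poly s) v → coeff (circ m g) v ≡
  ℤsum (List.tabulate (λ i → coeff (((var i ⊖ prevVar i) ^P (m ∸ 1)) ⊗ omit i g) v))
  + neg1^ m * ℤsum (List.tabulate (λ j → coeff (((var (inject₁ j) ⊖ var (suc j)) ^P (m ∸ 1)) ⊗ omit (inject₁ j) g) v))
coeff-circ {s} m g v =
  trans (coeff-⊕ (sumP (List.map f (List.allFin (suc s)))) (scaleP (neg1^ m) (sumP (List.map h (List.allFin s)))) v)
        (cong₂ _+_ (coeff-sumP-tabulate (λ i → i) f v)
                   (trans (coeff-scaleP (neg1^ m) (sumP (List.map h (List.allFin s))) v)
                          (cong (neg1^ m *_) (coeff-sumP-tabulate (λ j → j) h v))))
  where
  f : Fin (suc s) → Poly (suc s)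
  f i = ((var i ⊖ prevVar i) ^P (m ∸ 1)) ⊗ omit i g
  h : Fin s → Poly (suc s)
  h j = ((var (inject₁ j) ⊖ var (suc j)) ^P (m ∸ 1)) ⊗ omit (inject₁ j) g

shiftedCoeff : ∀ {n} → Poly n → Vec ℕ n → Vec ℕ n → ℤ
shiftedCoeff [] w v = + 0
shiftedCoeff ((c , f) ∷ p) w v = (if (f +ᵛ w) ==ᵛ v then c else + 0) + shiftedCoeff p w v

coeff-⊗-monomial : ∀ {n} (p : Poly n) w v → coeff (p ⊗ monomial w) v ≡ shiftedCoeff p w v
coeff-⊗-monomial [] w v = refl
coeff-⊗-monomial ((c , f) ∷ p) w v =
  cong₂ _+_ (cong (λ z → if (f +ᵛ w) ==ᵛ v then z else + 0) (ℤₚ.*-identityʳ c)) (coeff-⊗-monomial p w v)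

shiftedCoeff-monomial : ∀ {n} (u w v : Vec ℕ n) → shiftedCoeff (monomial u) w v ≡ (if (u +ᵛ w) ==ᵛ v then + 1 else + 0)
shiftedCoeff-monomial u w v = ℤₚ.+-identityʳ _

shiftedCoeff-++ : ∀ {n} (p q : Poly n) w v → shiftedCoeff (p ++ q) w v ≡ shiftedCoeff p w v + shiftedCoeff q w v
shiftedCoeff-++ [] q w v = sym (ℤₚ.+-identityˡ _)
shiftedCoeff-++ ((c , f) ∷ p) q w v =
  trans (cong (λ z → x + z) (shiftedCoeff-++ p q w v)) (sym (ℤₚ.+-assoc x (shiftedCoeff p w v) (shiftedCoeff q w v)))
  where x = if (f +ᵛ w) ==ᵛ v then c else + 0

shiftedCoeff-∷⊗ : ∀ {n} c f (d p : Poly n) w v →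
                  shiftedCoeff (((c , f) ∷ d) ⊗ p) w v ≡ c * shiftedCoeff p (f +ᵛ w) v + shiftedCoeff (d ⊗ p) w v
shiftedCoeff-∷⊗ c f d p w v = trans (shiftedCoeff-++ (List.map term p) (d ⊗ p) w v) (cong₂ _+_ (shifted-map p) refl)
  where
  term : ℤ × Vec ℕ _ → ℤ × Vec ℕ _
  term (b′ , h) = (c * b′ , f +ᵛ h)

  exchange : ∀ h → f +ᵛ h +ᵛ w ≡ h +ᵛ (f +ᵛ w)
  exchange h = trans (cong (_+ᵛ w) (Vecₚ.zipWith-comm ℕₚ.+-comm f h)) (Vecₚ.zipWith-assoc ℕₚ.+-assoc h f w)

  shifted-map : ∀ p → shiftedCoeff (List.map term p) w v ≡ c * shiftedCoeff p (f +ᵛ w) v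
  shifted-map [] = sym (ℤₚ.*-zeroʳ c)
  shifted-map ((b′ , h) ∷ p) =
    trans (cong₂ _+_ (trans (cong (λ u → if u ==ᵛ v then c * b′ else + 0) (exchange h)) (*-if _ c b′)) (shifted-map p))
          (sym (ℤₚ.*-distribˡ-+ c _ (shiftedCoeff p (f +ᵛ w) v)))

-- Monomials under renaming of variables

unit : ∀ {n} → Fin n → Vec ℕ n
unit i = tabulate (λ j → if ⌊ i Fin.≟ j ⌋ then 1 else 0)

unitPow : ∀ {n} → Fin n → ℕ → Vec ℕ n
unitPow i zero = replicate _ 0
unitPow i (suc k) = unit i +ᵛ unitPow i k

var-^P : ∀ {n} (i : Fin n) k → var i ^P k ≡ monomial (unitPow i k)
var-^P i zero = refl
var-^P i (suc k) rewrite var-^P i k = refl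

lookup-unit-+ᵛ : ∀ {n} (i p : Fin n) w → lookup (unit i +ᵛ w) p ≡ (if ⌊ i Fin.≟ p ⌋ then 1 else 0) ℕ.+ lookup w p
lookup-unit-+ᵛ i p w =
  trans (Vecₚ.lookup-zipWith ℕ._+_ p (unit i) w) (cong (ℕ._+ lookup w p) (Vecₚ.lookup∘tabulate _ p))

lookup-unit-+ᵛ-self : ∀ {n} (i : Fin n) w → lookup (unit i +ᵛ w) i ≡ suc (lookup w i)
lookup-unit-+ᵛ-self i w rewrite lookup-unit-+ᵛ i i w | ⌊⌋-true (i Fin.≟ i) refl = refl

lookup-unit-+ᵛ-other : ∀ {n} {i p : Fin n} → i ≢ p → ∀ w → lookup (unit i +ᵛ w) p ≡ lookup w p
lookup-unit-+ᵛ-other {i = i} {p} i≢p w rewrite lookup-unit-+ᵛ i p w | ⌊⌋-false (i Fin.≟ p) i≢p = refl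

unit-zero : ∀ {n} → unit {suc n} zero ≡ 1 ∷ replicate n 0
unit-zero = cong (1 ∷_) (lookup-extensionality (λ p → trans (Vecₚ.lookup∘tabulate _ p) (sym (Vecₚ.lookup-replicate p 0))))

unit-suc : ∀ {n} (i : Fin n) → unit (suc i) ≡ 0 ∷ unit i
unit-suc i = cong (0 ∷_) (Vecₚ.tabulate-cong (λ j → cong (λ t → if t then 1 else 0) (⌊⌋-map′ _ _ (i Fin.≟ j))))

unitPow-zero : ∀ {n} k → unitPow {suc n} zero k ≡ k ∷ replicate n 0
unitPow-zero zero = refl
unitPow-zero (suc k) = trans (cong₂ _+ᵛ_ unit-zero (unitPow-zero k)) (cong (suc k ∷_) (+ᵛ-identityˡ _))

unitPow-suc : ∀ {n} (i : Fin n) k → unitPow (suc i) k ≡ 0 ∷ unitPow i k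
unitPow-suc i zero = refl
unitPow-suc i (suc k) = cong₂ _+ᵛ_ (unit-suc i) (unitPow-suc i k)

exponentSum : ∀ {m n} → (Fin m → Fin n) → (Fin m → ℕ) → Vec ℕ n
exponentSum {zero} ρ c = replicate _ 0
exponentSum {suc m} ρ c = unitPow (ρ zero) (c zero) +ᵛ exponentSum (ρ ∘ suc) (c ∘ suc)

prodP-var-^P : ∀ {m n} (ρ : Fin m → Fin n) (c : Fin m → ℕ) →
               prodP (List.tabulate (λ k → var (ρ k) ^P c k)) ≡ monomial (exponentSum ρ c)
prodP-var-^P {zero} ρ c = refl
prodP-var-^P {suc m} ρ c rewrite prodP-var-^P (ρ ∘ suc) (c ∘ suc) | var-^P (ρ zero) (c zero) = refl

rename-monomial : ∀ {s t} (ρ : Fin s → Fin t) (a : Vec ℕ s) → rename ρ (monomial a) ≡ monomial (exponentSum ρ (lookup a))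
rename-monomial ρ a
  rewrite Listₚ.map-tabulate (λ k → k) (λ k → var (ρ k) ^P lookup a k) | prodP-var-^P ρ (lookup a) = refl

exponentSum-suc : ∀ {m n} (ρ : Fin m → Fin n) c → exponentSum (λ k → suc (ρ k)) c ≡ 0 ∷ exponentSum ρ c
exponentSum-suc {zero} ρ c = refl
exponentSum-suc {suc m} ρ c = cong₂ _+ᵛ_ (unitPow-suc (ρ zero) (c zero)) (exponentSum-suc (ρ ∘ suc) (c ∘ suc))

unitPow-zero-+ᵛ : ∀ {n} x (a : Vec ℕ n) → unitPow zero x +ᵛ (0 ∷ a) ≡ x ∷ a
unitPow-zero-+ᵛ x a = trans (cong (_+ᵛ (0 ∷ a)) (unitPow-zero x)) (cong₂ _∷_ (ℕₚ.+-identityʳ x) (+ᵛ-identityˡ a))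

exponentSum-lookup : ∀ {n} (a : Vec ℕ n) → exponentSum (λ k → k) (lookup a) ≡ a
exponentSum-lookup [] = refl
exponentSum-lookup (x ∷ a) =
  trans (cong (unitPow zero x +ᵛ_) (trans (exponentSum-suc (λ k → k) (lookup a)) (cong (0 ∷_) (exponentSum-lookup a))))
        (unitPow-zero-+ᵛ x a)

exponentSum-punchIn : ∀ {s} (i : Fin (suc s)) (a : Vec ℕ s) → exponentSum (punchIn i) (lookup a) ≡ insertAt a i 0
exponentSum-punchIn zero a = trans (exponentSum-suc (λ k → k) (lookup a)) (cong (0 ∷_) (exponentSum-lookup a))
exponentSum-punchIn (suc i) (x ∷ a) =
  trans (cong (unitPow zero x +ᵛ_) (trans (exponentSum-suc (punchIn i) (lookup a)) (cong (0 ∷_) (exponentSum-punchIn i a))))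
        (unitPow-zero-+ᵛ x _)

omit-monomial : ∀ {s} (i : Fin (suc s)) (a : Vec ℕ s) → omit i (monomial a) ≡ monomial (insertAt a i 0)
omit-monomial i a = trans (rename-monomial (punchIn i) a) (cong monomial (exponentSum-punchIn i a))

-- Powers of a difference of two variables

shiftedCoeff-binomial-⊗ : ∀ {n} (α β : Fin n) p w v →
  shiftedCoeff ((var α ⊖ var β) ⊗ p) w v ≡ shiftedCoeff p (unit α +ᵛ w) v - shiftedCoeff p (unit β +ᵛ w) v
shiftedCoeff-binomial-⊗ α β p w v = begin
  shiftedCoeff ((var α ⊖ var β) ⊗ p) w v
    ≡⟨ shiftedCoeff-∷⊗ (+ 1) (unit α) (negP (var β)) p w v ⟩
  + 1 * X + shiftedCoeff (negP (var β) ⊗ p) w v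
    ≡⟨ cong₂ _+_ (ℤₚ.*-identityˡ X) (shiftedCoeff-∷⊗ (- + 1 * + 1) (unit β) [] p w v) ⟩
  X + (- + 1 * + 1 * Y + + 0)
    ≡⟨ cong (λ z → X + z) (trans (ℤₚ.+-identityʳ _) (ℤₚ.-1*i≡-i Y)) ⟩
  X - Y ∎
  where
  open ≡-Reasoning
  X = shiftedCoeff p (unit α +ᵛ w) v
  Y = shiftedCoeff p (unit β +ᵛ w) v

atMinus : ℕ → ℕ → (ℕ → ℤ) → ℤ
atMinus x zero f = f x
atMinus zero (suc p) f = + 0
atMinus (suc x) (suc p) f = atMinus x p f

atMinus-≤ : ∀ {x p} f → p ≤ x → atMinus x p f ≡ f (x ∸ p)
atMinus-≤ {p = zero} f z≤n = refl
atMinus-≤ {p = suc p} f (s≤s p≤x) = atMinus-≤ f p≤x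

atMinus-< : ∀ {x p} f → x < p → atMinus x p f ≡ + 0
atMinus-< {zero} {suc p} f _ = refl
atMinus-< {suc x} {suc p} f (s≤s x<p) = atMinus-< f x<p

atMinus-self : ∀ x f → atMinus x x f ≡ f 0
atMinus-self zero f = refl
atMinus-self (suc x) f = atMinus-self x f

atMinus-cong : ∀ x p {f g} → (∀ a → f a ≡ g a) → atMinus x p f ≡ atMinus x p g
atMinus-cong x zero f≗g = f≗g x
atMinus-cong zero (suc p) f≗g = refl
atMinus-cong (suc x) (suc p) f≗g = atMinus-cong x p f≗g

atMinus-const-0 : ∀ x p → atMinus x p (λ _ → + 0) ≡ + 0
atMinus-const-0 x zero = refl
atMinus-const-0 zero (suc p) = refl
atMinus-const-0 (suc x) (suc p) = atMinus-const-0 x p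

atMinus-− : ∀ x p f g → atMinus x p f - atMinus x p g ≡ atMinus x p (λ a → f a - g a)
atMinus-− x zero f g = refl
atMinus-− zero (suc p) f g = refl
atMinus-− (suc x) (suc p) f g = atMinus-− x p f g

atMinus-suc : ∀ x p f → atMinus x (suc p) f ≡ atMinus x p (λ a → atMinus a 1 f)
atMinus-suc zero zero f = refl
atMinus-suc (suc x) zero f = refl
atMinus-suc zero (suc p) f = refl
atMinus-suc (suc x) (suc p) f = atMinus-suc x p f

atMinus-comm : ∀ x p y q (f : ℕ → ℕ → ℤ) →
               atMinus x p (λ a → atMinus y q (f a)) ≡ atMinus y q (λ b → atMinus x p (λ a → f a b))
atMinus-comm x zero y q f = refl
atMinus-comm zero (suc p) y q f = sym (atMinus-const-0 y q)
atMinus-comm (suc x) (suc p) y q f = atMinus-comm x p y q f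

atMinus-vanishes : ∀ {x p} f → x ≢ p → (∀ a → f (suc a) ≡ + 0) → atMinus x p f ≡ + 0
atMinus-vanishes {zero} {zero} f x≢p _ = ⊥-elim (x≢p refl)
atMinus-vanishes {suc x} {zero} f _ f-suc = f-suc x
atMinus-vanishes {zero} {suc p} f _ _ = refl
atMinus-vanishes {suc x} {suc p} f x≢p f-suc = atMinus-vanishes f (x≢p ∘ cong suc) f-suc

diffPowCoeff : ℕ → ℕ → ℕ → ℤ
diffPowCoeff K a b = if ⌊ a ℕ.+ b ℕ.≟ K ⌋ then neg1^ b * + (K C b) else + 0

⌊suc≟suc⌋ : ∀ x y → ⌊ suc x ℕ.≟ suc y ⌋ ≡ ⌊ x ℕ.≟ y ⌋
⌊suc≟suc⌋ x y = ⌊⌋-⇔ (mk⇔ ℕₚ.suc-injective (cong suc)) (suc x ℕ.≟ suc y) (x ℕ.≟ y)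

diffPowCoeff-suc : ∀ K a b →
  diffPowCoeff (suc K) a b ≡ atMinus a 1 (λ a′ → diffPowCoeff K a′ b) - atMinus b 1 (diffPowCoeff K a)
diffPowCoeff-suc K zero zero = refl
diffPowCoeff-suc K (suc a) zero rewrite ⌊suc≟suc⌋ (a ℕ.+ 0) K = sym (ℤₚ.+-identityʳ _)
diffPowCoeff-suc K zero (suc b) rewrite ⌊suc≟suc⌋ b K with b ℕ.≟ K
... | yes refl rewrite nCn≡1 b | nCn≡1 (suc b) =
  trans (sym (ℤₚ.neg-distribˡ-* (neg1^ b) (+ 1))) (sym (ℤₚ.+-identityˡ _))
... | no _ = refl
diffPowCoeff-suc K (suc a) (suc b) rewrite ⌊suc≟suc⌋ (a ℕ.+ suc b) K | ℕₚ.+-suc a b with suc (a ℕ.+ b) ℕ.≟ K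
... | yes refl = sym (begin
  - σ * + (K C suc b) - σ * + (K C b)    ≡⟨ cong (λ z → - σ * + (K C suc b) + z) (ℤₚ.neg-distribˡ-* σ (+ (K C b))) ⟩
  - σ * + (K C suc b) + - σ * + (K C b)  ≡⟨ sym (ℤₚ.*-distribˡ-+ (- σ) (+ (K C suc b)) (+ (K C b))) ⟩
  - σ * + (K C suc b ℕ.+ K C b)
    ≡⟨ cong (λ z → - σ * + z) (trans (ℕₚ.+-comm (K C suc b) (K C b)) (nCk+nC[k+1]≡[n+1]C[k+1] K b)) ⟩
  - σ * + (suc K C suc b)                ∎)
  where
  open ≡-Reasoning
  σ = neg1^ b
... | no _ = refl

-- The coefficient of X^x Y^y in X^p Y^q (X − Y)^K.
shiftedDiffPowCoeff : ℕ → ℕ → ℕ → ℕ → ℕ → ℤ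
shiftedDiffPowCoeff K x p y q = atMinus x p (λ a → atMinus y q (diffPowCoeff K a))

shiftedDiffPowCoeff-suc : ∀ K x p y q →
  shiftedDiffPowCoeff (suc K) x p y q ≡ shiftedDiffPowCoeff K x (suc p) y q - shiftedDiffPowCoeff K x p y (suc q)
shiftedDiffPowCoeff-suc K x p y q = sym (begin
  shiftedDiffPowCoeff K x (suc p) y q - shiftedDiffPowCoeff K x p y (suc q)
    ≡⟨ cong₂ _-_ (atMinus-suc x p _) (atMinus-cong x p (λ a → atMinus-suc y q (diffPowCoeff K a))) ⟩
  atMinus x p (λ a → atMinus a 1 (λ a′ → atMinus y q (diffPowCoeff K a′)))
    - atMinus x p (λ a → atMinus y q (λ b → atMinus b 1 (diffPowCoeff K a)))
    ≡⟨ atMinus-− x p _ _ ⟩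
  atMinus x p (λ a → atMinus a 1 (λ a′ → atMinus y q (diffPowCoeff K a′))
                   - atMinus y q (λ b → atMinus b 1 (diffPowCoeff K a)))
    ≡⟨ atMinus-cong x p (λ a → begin
         atMinus a 1 (λ a′ → atMinus y q (diffPowCoeff K a′)) - atMinus y q (λ b → atMinus b 1 (diffPowCoeff K a))
           ≡⟨ cong (_- atMinus y q (λ b → atMinus b 1 (diffPowCoeff K a))) (atMinus-comm a 1 y q (diffPowCoeff K)) ⟩
         atMinus y q (λ b → atMinus a 1 (λ a′ → diffPowCoeff K a′ b)) - atMinus y q (λ b → atMinus b 1 (diffPowCoeff K a))
           ≡⟨ atMinus-− y q _ _ ⟩
         atMinus y q (λ b → atMinus a 1 (λ a′ → diffPowCoeff K a′ b) - atMinus b 1 (diffPowCoeff K a))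
           ≡⟨ atMinus-cong y q (λ b → sym (diffPowCoeff-suc K a b)) ⟩
         atMinus y q (diffPowCoeff (suc K) a) ∎) ⟩
  shiftedDiffPowCoeff (suc K) x p y q ∎)
  where open ≡-Reasoning

shiftedDiffPowCoeff-zero-self : ∀ x y → shiftedDiffPowCoeff 0 x x y y ≡ + 1
shiftedDiffPowCoeff-zero-self x y = trans (atMinus-self x _) (atMinus-self y _)

shiftedDiffPowCoeff-zero-≢ˡ : ∀ {x p} y q → x ≢ p → shiftedDiffPowCoeff 0 x p y q ≡ + 0
shiftedDiffPowCoeff-zero-≢ˡ y q x≢p = atMinus-vanishes _ x≢p (λ a → atMinus-const-0 y q)

shiftedDiffPowCoeff-zero-≢ʳ : ∀ x p {y q} → y ≢ q → shiftedDiffPowCoeff 0 x p y q ≡ + 0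
shiftedDiffPowCoeff-zero-≢ʳ x p y≢q =
  trans (atMinus-cong x p (λ a → atMinus-vanishes _ y≢q (λ b → diffPowCoeff-zero-suc a b))) (atMinus-const-0 x p)
  where
  diffPowCoeff-zero-suc : ∀ a b → diffPowCoeff 0 a (suc b) ≡ + 0
  diffPowCoeff-zero-suc a b rewrite ℕₚ.+-suc a b = refl

AgreeOff : ∀ {n} → Fin n → Fin n → Vec ℕ n → Vec ℕ n → Set
AgreeOff α β w v = ∀ p → p ≢ α → p ≢ β → lookup w p ≡ lookup v p

agreeOff? : ∀ {n} (α β : Fin n) w v → Dec (AgreeOff α β w v)
agreeOff? α β w v = Finₚ.all? (λ p → ¬? (p Fin.≟ α) →-dec ¬? (p Fin.≟ β) →-dec lookup w p ℕ.≟ lookup v p)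

module _ {n} {α β : Fin n} (α≢β : α ≢ β) where

  agreeOff-unit-+ᵛ : ∀ {γ} → γ ≡ α ⊎ γ ≡ β → ∀ w v → AgreeOff α β (unit γ +ᵛ w) v ⇔ AgreeOff α β w v
  agreeOff-unit-+ᵛ γ∈αβ w v = mk⇔
    (λ ag p p≢α p≢β → trans (sym (lookup-unit-+ᵛ-other (γ≢p γ∈αβ p≢α p≢β) w)) (ag p p≢α p≢β))
    (λ ag p p≢α p≢β → trans (lookup-unit-+ᵛ-other (γ≢p γ∈αβ p≢α p≢β) w) (ag p p≢α p≢β))
    where
    γ≢p : ∀ {γ p} → γ ≡ α ⊎ γ ≡ β → p ≢ α → p ≢ β → γ ≢ p
    γ≢p (inj₁ refl) p≢α _ = p≢α ∘ sym
    γ≢p (inj₂ refl) _ p≢β = p≢β ∘ sym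

  agreeOff-≡ : ∀ {w v} → AgreeOff α β w v → lookup w α ≡ lookup v α → lookup w β ≡ lookup v β → w ≡ v
  agreeOff-≡ {w} {v} ag wα≡vα wβ≡vβ = lookup-extensionality agree
    where
    agree : ∀ p → lookup w p ≡ lookup v p
    agree p with p Fin.≟ α | p Fin.≟ β
    ... | yes refl | _ = wα≡vα
    ... | no _ | yes refl = wβ≡vβ
    ... | no p≢α | no p≢β = ag p p≢α p≢β

  ==ᵛ-agreeOff : ∀ w v → (if w ==ᵛ v then + 1 else + 0) ≡
    (if ⌊ agreeOff? α β w v ⌋ then shiftedDiffPowCoeff 0 (lookup v α) (lookup w α) (lookup v β) (lookup w β) else + 0)
  ==ᵛ-agreeOff w v with Vecₚ.≡-dec ℕ._≟_ w v
  ... | yes refl rewrite ⌊⌋-true (agreeOff? α β w w) (λ _ _ _ → refl) =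
    sym (shiftedDiffPowCoeff-zero-self (lookup w α) (lookup w β))
  ... | no w≢v with agreeOff? α β w v
  ...   | no _ = refl
  ...   | yes ag with lookup v α ℕ.≟ lookup w α | lookup v β ℕ.≟ lookup w β
  ...     | no vα≢wα | _ = sym (shiftedDiffPowCoeff-zero-≢ˡ (lookup v β) (lookup w β) vα≢wα)
  ...     | yes _ | no vβ≢wβ = sym (shiftedDiffPowCoeff-zero-≢ʳ (lookup v α) (lookup w α) vβ≢wβ)
  ...     | yes vα≡wα | yes vβ≡wβ = ⊥-elim (w≢v (agreeOff-≡ ag (sym vα≡wα) (sym vβ≡wβ)))

  shiftedCoeff-diffPow : ∀ K w v → shiftedCoeff ((var α ⊖ var β) ^P K) w v ≡
    (if ⌊ agreeOff? α β w v ⌋ then shiftedDiffPowCoeff K (lookup v α) (lookup w α) (lookup v β) (lookup w β) else + 0)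
  shiftedCoeff-diffPow zero w v =
    trans (shiftedCoeff-monomial _ w v) (trans (cong (λ u → if u ==ᵛ v then + 1 else + 0) (+ᵛ-identityˡ w)) (==ᵛ-agreeOff w v))
  shiftedCoeff-diffPow (suc K) w v = begin
    shiftedCoeff ((var α ⊖ var β) ⊗ P) w v
      ≡⟨ shiftedCoeff-binomial-⊗ α β P w v ⟩
    shiftedCoeff P (unit α +ᵛ w) v - shiftedCoeff P (unit β +ᵛ w) v
      ≡⟨ cong₂ _-_ (shiftedCoeff-diffPow K _ v) (shiftedCoeff-diffPow K _ v) ⟩
    (if ⌊ agreeOff? α β (unit α +ᵛ w) v ⌋
       then shifted K (lookup (unit α +ᵛ w) α) (lookup (unit α +ᵛ w) β) else + 0)
      - (if ⌊ agreeOff? α β (unit β +ᵛ w) v ⌋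
           then shifted K (lookup (unit β +ᵛ w) α) (lookup (unit β +ᵛ w) β) else + 0)
      ≡⟨ cong₂ _-_
           (cong₂ (λ t z → if t then z else + 0)
                  (⌊⌋-⇔ (agreeOff-unit-+ᵛ (inj₁ refl) w v) (agreeOff? α β (unit α +ᵛ w) v) (agreeOff? α β w v))
                  (cong₂ (shifted K) (lookup-unit-+ᵛ-self α w) (lookup-unit-+ᵛ-other α≢β w)))
           (cong₂ (λ t z → if t then z else + 0)
                  (⌊⌋-⇔ (agreeOff-unit-+ᵛ (inj₂ refl) w v) (agreeOff? α β (unit β +ᵛ w) v) (agreeOff? α β w v))
                  (cong₂ (shifted K) (lookup-unit-+ᵛ-other (α≢β ∘ sym) w) (lookup-unit-+ᵛ-self β w))) ⟩
    (if agree then shifted K (suc (lookup w α)) (lookup w β) else + 0)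
      - (if agree then shifted K (lookup w α) (suc (lookup w β)) else + 0)
      ≡⟨ if-− agree _ _ ⟩
    (if agree then shifted K (suc (lookup w α)) (lookup w β) - shifted K (lookup w α) (suc (lookup w β)) else + 0)
      ≡⟨ cong (λ z → if agree then z else + 0)
              (sym (shiftedDiffPowCoeff-suc K (lookup v α) (lookup w α) (lookup v β) (lookup w β))) ⟩
    (if agree then shifted (suc K) (lookup w α) (lookup w β) else + 0) ∎
    where
    open ≡-Reasoning
    P = (var α ⊖ var β) ^P K
    agree = ⌊ agreeOff? α β w v ⌋
    shifted : ℕ → ℕ → ℕ → ℤ
    shifted K p q = shiftedDiffPowCoeff K (lookup v α) p (lookup v β) q

-- Closed form of the coefficients

neg1^-+ : ∀ a c → neg1^ (a ℕ.+ c) ≡ neg1^ a * neg1^ c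
neg1^-+ zero c = sym (ℤₚ.*-identityˡ _)
neg1^-+ (suc a) c = trans (cong -_ (neg1^-+ a c)) (ℤₚ.neg-distribˡ-* (neg1^ a) (neg1^ c))

neg1^-square : ∀ a → neg1^ a * neg1^ a ≡ + 1
neg1^-square zero = refl
neg1^-square (suc a) = begin
  - x * - x     ≡⟨ sym (ℤₚ.neg-distribˡ-* x (- x)) ⟩
  - (x * - x)   ≡⟨ cong -_ (sym (ℤₚ.neg-distribʳ-* x x)) ⟩
  - - (x * x)   ≡⟨ ℤₚ.neg-involutive (x * x) ⟩
  x * x         ≡⟨ neg1^-square a ⟩
  + 1           ∎
  where
  open ≡-Reasoning
  x = neg1^ a

neg1^-∸ : ∀ {X M} → X ≤ M → neg1^ (M ∸ X) ≡ neg1^ℤ (+ suc X - + suc M)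
neg1^-∸ {X} {M} X≤M = cong neg1^ (sym (begin
  ℤ.∣ + suc X - + suc M ∣  ≡⟨ cong ℤ.∣_∣ (trans (ℤₚ.m-n≡m⊖n (suc X) (suc M)) (ℤₚ.[1+m]⊖[1+n]≡m⊖n X M)) ⟩
  ℤ.∣ X ℤ.⊖ M ∣            ≡⟨ ℤₚ.∣⊖∣-≤ X≤M ⟩
  M ∸ X                    ∎))
  where open ≡-Reasoning

neg1^-suc-∸ : ∀ {Y M} → Y ≤ M → neg1^ (suc M) * neg1^ (M ∸ Y) ≡ neg1^ (suc Y)
neg1^-suc-∸ {Y} {M} Y≤M = begin
  neg1^ (suc M) * neg1^ t               ≡⟨ cong (λ z → neg1^ (suc z) * neg1^ t) (sym (ℕₚ.m+[n∸m]≡n Y≤M)) ⟩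
  neg1^ (suc Y ℕ.+ t) * neg1^ t         ≡⟨ cong (_* neg1^ t) (neg1^-+ (suc Y) t) ⟩
  neg1^ (suc Y) * neg1^ t * neg1^ t     ≡⟨ ℤₚ.*-assoc (neg1^ (suc Y)) (neg1^ t) (neg1^ t) ⟩
  neg1^ (suc Y) * (neg1^ t * neg1^ t)   ≡⟨ cong (neg1^ (suc Y) *_) (neg1^-square t) ⟩
  neg1^ (suc Y) * + 1                   ≡⟨ ℤₚ.*-identityʳ _ ⟩
  neg1^ (suc Y)                         ∎
  where
  open ≡-Reasoning
  t = M ∸ Y

*-C-cong : ∀ {s s′} M X → (X ≤ M → s ≡ s′) → s * + (M C X) ≡ s′ * + (M C X)
*-C-cong {s} {s′} M X s≡s′ with X ℕ.≤? M
... | yes X≤M = cong (_* + (M C X)) (s≡s′ X≤M)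
... | no X≰M rewrite k>n⇒nCk≡0 (ℕₚ.≰⇒> X≰M) = trans (ℤₚ.*-zeroʳ s) (sym (ℤₚ.*-zeroʳ s′))

atMinus-diffPowCoeff : ∀ M A X Y → M ℕ.+ A ≡ X ℕ.+ Y → atMinus Y A (diffPowCoeff M X) ≡ neg1^ (M ∸ X) * + (M C X)
atMinus-diffPowCoeff M A X Y M+A≡X+Y with A ℕ.≤? Y
... | yes A≤Y = begin
  atMinus Y A (diffPowCoeff M X)
    ≡⟨ atMinus-≤ _ A≤Y ⟩
  diffPowCoeff M X t
    ≡⟨ cong (λ c → if c then neg1^ t * + (M C t) else + 0) (⌊⌋-true (X ℕ.+ t ℕ.≟ M) X+t≡M) ⟩
  neg1^ t * + (M C t)
    ≡⟨ cong₂ (λ u c → neg1^ u * + c) t≡M∸X (trans (nCk≡nC[n∸k] t≤M) (cong (M C_) M∸t≡X)) ⟩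
  neg1^ (M ∸ X) * + (M C X) ∎
  where
  open ≡-Reasoning
  t = Y ∸ A
  X+t≡M : X ℕ.+ t ≡ M
  X+t≡M = ℕₚ.+-cancelʳ-≡ A (X ℕ.+ t) M (begin
    X ℕ.+ t ℕ.+ A    ≡⟨ ℕₚ.+-assoc X t A ⟩
    X ℕ.+ (t ℕ.+ A)  ≡⟨ cong (X ℕ.+_) (ℕₚ.m∸n+n≡m A≤Y) ⟩
    X ℕ.+ Y          ≡⟨ sym M+A≡X+Y ⟩
    M ℕ.+ A          ∎)
  t≤M : t ≤ M
  t≤M = ℕₚ.≤-trans (ℕₚ.m≤n+m t X) (ℕₚ.≤-reflexive X+t≡M)
  t≡M∸X : t ≡ M ∸ X
  t≡M∸X = trans (sym (ℕₚ.m+n∸m≡n X t)) (cong (_∸ X) X+t≡M)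
  M∸t≡X : M ∸ t ≡ X
  M∸t≡X = trans (cong (_∸ t) (sym X+t≡M)) (ℕₚ.m+n∸n≡m X t)
... | no A≰Y =
  trans (atMinus-< _ Y<A) (sym (trans (cong (λ c → neg1^ (M ∸ X) * + c) (k>n⇒nCk≡0 M<X)) (ℤₚ.*-zeroʳ (neg1^ (M ∸ X)))))
  where
  Y<A : Y < A
  Y<A = ℕₚ.≰⇒> A≰Y
  M<X : M < X
  M<X = ℕₚ.+-cancelʳ-< A M X (ℕₚ.≤-<-trans (ℕₚ.≤-reflexive M+A≡X+Y) (ℕₚ.+-monoʳ-< X Y<A))

b≡atMinus-diffPowCoeff : ∀ {m n n′} A → 1 ≤ m → 1 ≤ n → 1 ≤ n′ →
  (m ∸ 1) ℕ.+ A ≡ (n′ ∸ 1) ℕ.+ (n ∸ 1) →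
  atMinus (n ∸ 1) A (diffPowCoeff (m ∸ 1) (n′ ∸ 1)) + neg1^ m * atMinus (n′ ∸ 1) A (diffPowCoeff (m ∸ 1) (n ∸ 1))
    ≡ b m n n′
b≡atMinus-diffPowCoeff {suc M} {suc Y} {suc X} A (s≤s _) (s≤s _) (s≤s _) M+A≡X+Y = begin
  atMinus Y A (diffPowCoeff M X) + neg1^ (suc M) * atMinus X A (diffPowCoeff M Y)
    ≡⟨ cong₂ (λ u w → u + neg1^ (suc M) * w)
             (atMinus-diffPowCoeff M A X Y M+A≡X+Y) (atMinus-diffPowCoeff M A Y X (trans M+A≡X+Y (ℕₚ.+-comm X Y))) ⟩
  neg1^ (M ∸ X) * + (M C X) + neg1^ (suc M) * (neg1^ (M ∸ Y) * + (M C Y))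
    ≡⟨ cong₂ _+_ (*-C-cong M X neg1^-∸)
                 (trans (sym (ℤₚ.*-assoc (neg1^ (suc M)) _ _)) (*-C-cong M Y neg1^-suc-∸)) ⟩
  neg1^ℤ (+ suc X - + suc M) * + (M C X) + neg1^ (suc Y) * + (M C Y)
    ≡⟨ ℤₚ.+-comm (neg1^ℤ (+ suc X - + suc M) * + (M C X)) (neg1^ (suc Y) * + (M C Y)) ⟩
  b (suc M) (suc Y) (suc X) ∎
  where open ≡-Reasoning

-- Two adjacent positions

inject₁≢suc : ∀ {k} (j : Fin k) → inject₁ j ≢ suc j
inject₁≢suc (suc j) eq = inject₁≢suc j (Finₚ.suc-injective eq)

lookup-insertAt-suc : ∀ {k} (j : Fin k) (a : Vec ℕ k) x → lookup (insertAt a (suc j) x) (inject₁ j) ≡ lookup a j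
lookup-insertAt-suc zero (y ∷ a) x = refl
lookup-insertAt-suc (suc j) (y ∷ a) x = lookup-insertAt-suc j a x

lookup-insertAt-inject₁ : ∀ {k} (j : Fin k) (a : Vec ℕ k) x → lookup (insertAt a (inject₁ j) x) (suc j) ≡ lookup a j
lookup-insertAt-inject₁ zero (y ∷ a) x = refl
lookup-insertAt-inject₁ (suc j) (y ∷ a) x = lookup-insertAt-inject₁ j a x

dropAt : ∀ {k} → Fin k → Vec ℕ k → List ℕ
dropAt j a = take (toℕ j) (Vec.toList a) ++ drop (suc (toℕ j)) (Vec.toList a)

dropAt-map : ∀ {k} (f : ℕ → ℕ) (j : Fin k) a → dropAt j (Vec.map f a) ≡ List.map f (dropAt j a)
dropAt-map f j a = begin
  take (toℕ j) (Vec.toList (Vec.map f a)) ++ drop (suc (toℕ j)) (Vec.toList (Vec.map f a))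
    ≡⟨ cong (λ l → take (toℕ j) l ++ drop (suc (toℕ j)) l) (Vecₚ.toList-map f a) ⟩
  take (toℕ j) (List.map f l) ++ drop (suc (toℕ j)) (List.map f l)
    ≡⟨ cong₂ _++_ (Listₚ.take-map (toℕ j) l) (Listₚ.drop-map (suc (toℕ j)) l) ⟩
  List.map f (take (toℕ j) l) ++ List.map f (drop (suc (toℕ j)) l)
    ≡⟨ sym (Listₚ.map-++ f (take (toℕ j) l) (drop (suc (toℕ j)) l)) ⟩
  List.map f (dropAt j a) ∎
  where
  open ≡-Reasoning
  l = Vec.toList a

removePair : ∀ {k} → Fin k → Vec ℕ (suc k) → List ℕ
removePair zero (x ∷ y ∷ u) = Vec.toList u
removePair (suc j) (x ∷ u) = x ∷ removePair j u

removePair-toList : ∀ {k} (j : Fin k) u →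
                    removePair j u ≡ take (toℕ j) (Vec.toList u) ++ drop (suc (suc (toℕ j))) (Vec.toList u)
removePair-toList zero (x ∷ y ∷ u) = refl
removePair-toList (suc j) (x ∷ u) = cong (x ∷_) (removePair-toList j u)

removePair-map : ∀ {k} (f : ℕ → ℕ) (j : Fin k) u → removePair j (Vec.map f u) ≡ List.map f (removePair j u)
removePair-map f zero (x ∷ y ∷ u) = Vecₚ.toList-map f u
removePair-map f (suc j) (x ∷ u) = cong (f x ∷_) (removePair-map f j u)

removePair-insertAt-suc : ∀ {k} (j : Fin k) a x → removePair j (insertAt a (suc j) x) ≡ dropAt j a
removePair-insertAt-suc zero (y ∷ a) x = refl
removePair-insertAt-suc (suc j) (y ∷ a) x = cong (y ∷_) (removePair-insertAt-suc j a x)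

removePair-insertAt-inject₁ : ∀ {k} (j : Fin k) a x → removePair j (insertAt a (inject₁ j) x) ≡ dropAt j a
removePair-insertAt-inject₁ zero (y ∷ a) x = refl
removePair-insertAt-inject₁ (suc j) (y ∷ a) x = cong (y ∷_) (removePair-insertAt-inject₁ j a x)

sum-toList : ∀ {n} (w : Vec ℕ n) → sum w ≡ ℕᴸ.sum (Vec.toList w)
sum-toList [] = refl
sum-toList (z ∷ w) = cong (z ℕ.+_) (sum-toList w)

sum-removePair : ∀ {k} (j : Fin k) u →
                 sum u ≡ lookup u (inject₁ j) ℕ.+ lookup u (suc j) ℕ.+ ℕᴸ.sum (removePair j u)
sum-removePair zero (x ∷ y ∷ u) = trans (cong (λ z → x ℕ.+ (y ℕ.+ z)) (sum-toList u)) (sym (ℕₚ.+-assoc x y _))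
sum-removePair (suc j) (x ∷ u) =
  trans (cong (x ℕ.+_) (sum-removePair j u))
        (x∙yz≈y∙xz x (lookup u (inject₁ j) ℕ.+ lookup u (suc j)) (ℕᴸ.sum (removePair j u)))

sum-dropAt : ∀ {k} (j : Fin k) a → sum a ≡ lookup a j ℕ.+ ℕᴸ.sum (dropAt j a)
sum-dropAt zero (x ∷ a) = cong (x ℕ.+_) (sum-toList a)
sum-dropAt (suc j) (x ∷ a) = trans (cong (x ℕ.+_) (sum-dropAt j a)) (x∙yz≈y∙xz x (lookup a j) (ℕᴸ.sum (dropAt j a)))

agreeOff-adjacent⇔ : ∀ {k} (j : Fin k) {u v} → AgreeOff (inject₁ j) (suc j) u v ⇔ (removePair j u ≡ removePair j v)
agreeOff-adjacent⇔ j = mk⇔ (from j) (to j)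
  where
  to : ∀ {k} (j : Fin k) {u v} → removePair j u ≡ removePair j v → AgreeOff (inject₁ j) (suc j) u v
  to zero {_ ∷ _ ∷ u} {_ ∷ _ ∷ v} eq zero p≢0 _ = ⊥-elim (p≢0 refl)
  to zero {_ ∷ _ ∷ u} {_ ∷ _ ∷ v} eq (suc zero) _ p≢1 = ⊥-elim (p≢1 refl)
  to zero {_ ∷ _ ∷ u} {_ ∷ _ ∷ v} eq (suc (suc p)) _ _ = cong (λ w → lookup w p) (toList-injective u v eq)
  to (suc j) {_ ∷ u} {_ ∷ v} eq zero _ _ = Listₚ.∷-injectiveˡ eq
  to (suc j) {_ ∷ u} {_ ∷ v} eq (suc p) p≢ p≢′ = to j (Listₚ.∷-injectiveʳ eq) p (p≢ ∘ cong suc) (p≢′ ∘ cong suc)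

  from : ∀ {k} (j : Fin k) {u v} → AgreeOff (inject₁ j) (suc j) u v → removePair j u ≡ removePair j v
  from zero {_ ∷ _ ∷ u} {_ ∷ _ ∷ v} ag = cong Vec.toList (lookup-extensionality (λ p → ag (suc (suc p)) (λ ()) (λ ())))
  from (suc j) {_ ∷ u} {_ ∷ v} ag =
    cong₂ _∷_ (ag zero (λ ()) (λ ()))
              (from j (λ p p≢ p≢′ → ag (suc p) (p≢ ∘ Finₚ.suc-injective) (p≢′ ∘ Finₚ.suc-injective)))

agreeOff-insertAt⇔ : ∀ {k} (j : Fin k) i a v → removePair j (insertAt a i 0) ≡ dropAt j a →
                     AgreeOff (inject₁ j) (suc j) (insertAt a i 0) v ⇔ (dropAt j a ≡ removePair j v)
agreeOff-insertAt⇔ j i a v removed = mk⇔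
  (λ ag → trans (sym removed) (Equivalence.to (agreeOff-adjacent⇔ j) ag))
  (λ eq → Equivalence.from (agreeOff-adjacent⇔ j) (trans removed eq))

coeff-diffPow-⊗-omit : ∀ {s} K {α β : Fin (suc s)} → α ≢ β → ∀ i a v →
  coeff (((var α ⊖ var β) ^P K) ⊗ omit i (monomial a)) v ≡
    (if ⌊ agreeOff? α β (insertAt a i 0) v ⌋
       then shiftedDiffPowCoeff K (lookup v α) (lookup (insertAt a i 0) α) (lookup v β) (lookup (insertAt a i 0) β)
       else + 0)
coeff-diffPow-⊗-omit K {α} {β} α≢β i a v =
  trans (cong (λ q → coeff (((var α ⊖ var β) ^P K) ⊗ q) v) (omit-monomial i a))
        (trans (coeff-⊗-monomial ((var α ⊖ var β) ^P K) (insertAt a i 0) v) (shiftedCoeff-diffPow α≢β K (insertAt a i 0) v))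

coeff-rising-⊗-omit : ∀ {s} M (j : Fin s) a v →
  coeff (((var (suc j) ⊖ var (inject₁ j)) ^P M) ⊗ omit (suc j) (monomial a)) v ≡
    (if ⌊ Listₚ.≡-dec ℕ._≟_ (dropAt j a) (removePair j v) ⌋
       then atMinus (lookup v (inject₁ j)) (lookup a j) (diffPowCoeff M (lookup v (suc j))) else + 0)
coeff-rising-⊗-omit M j a v = trans (coeff-diffPow-⊗-omit M (inject₁≢suc j ∘ sym) (suc j) a v)
  (cong₂ (λ t z → if t then z else + 0)
         (⌊⌋-⇔ agree⇔ (agreeOff? (suc j) (inject₁ j) W v) (Listₚ.≡-dec ℕ._≟_ (dropAt j a) (removePair j v)))
         (cong₂ (λ p q → shiftedDiffPowCoeff M (lookup v (suc j)) p (lookup v (inject₁ j)) q)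
                (Vecₚ.insertAt-lookup a (suc j) 0) (lookup-insertAt-suc j a 0)))
  where
  W = insertAt a (suc j) 0
  agree⇔ : AgreeOff (suc j) (inject₁ j) W v ⇔ (dropAt j a ≡ removePair j v)
  agree⇔ = mk⇔ (λ ag → Equivalence.to (agreeOff-insertAt⇔ j (suc j) a v (removePair-insertAt-suc j a 0)) (λ p x y → ag p y x))
               (λ eq p x y → Equivalence.from (agreeOff-insertAt⇔ j (suc j) a v (removePair-insertAt-suc j a 0)) eq p y x)

coeff-falling-⊗-omit : ∀ {s} M (j : Fin s) a v →
  coeff (((var (inject₁ j) ⊖ var (suc j)) ^P M) ⊗ omit (inject₁ j) (monomial a)) v ≡
    (if ⌊ Listₚ.≡-dec ℕ._≟_ (dropAt j a) (removePair j v) ⌋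
       then atMinus (lookup v (suc j)) (lookup a j) (diffPowCoeff M (lookup v (inject₁ j))) else + 0)
coeff-falling-⊗-omit M j a v = trans (coeff-diffPow-⊗-omit M (inject₁≢suc j) (inject₁ j) a v)
  (cong₂ (λ t z → if t then z else + 0)
         (⌊⌋-⇔ (agreeOff-insertAt⇔ j (inject₁ j) a v (removePair-insertAt-inject₁ j a 0))
               (agreeOff? (inject₁ j) (suc j) (insertAt a (inject₁ j) 0) v) (Listₚ.≡-dec ℕ._≟_ (dropAt j a) (removePair j v)))
         (cong₂ (λ p q → shiftedDiffPowCoeff M (lookup v (inject₁ j)) p (lookup v (suc j)) q)
                (Vecₚ.insertAt-lookup a (inject₁ j) 0) (lookup-insertAt-inject₁ j a 0)))

coeff-x₁^-⊗-omit-zero : ∀ {s} M (a : Vec ℕ s) v →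
  coeff ((var zero ^P M) ⊗ omit zero (monomial a)) v ≡ (if (M ∷ a) ==ᵛ v then + 1 else + 0)
coeff-x₁^-⊗-omit-zero M a v = begin
  coeff ((var zero ^P M) ⊗ omit zero (monomial a)) v
    ≡⟨ cong₂ (λ p q → coeff (p ⊗ q) v) (var-^P zero M) (omit-monomial zero a) ⟩
  coeff (monomial (unitPow zero M) ⊗ monomial (0 ∷ a)) v
    ≡⟨ trans (coeff-⊗-monomial (monomial (unitPow zero M)) (0 ∷ a) v) (shiftedCoeff-monomial (unitPow zero M) (0 ∷ a) v) ⟩
  (if (unitPow zero M +ᵛ (0 ∷ a)) ==ᵛ v then + 1 else + 0)
    ≡⟨ cong (λ u → if u ==ᵛ v then + 1 else + 0) (unitPow-zero-+ᵛ M a) ⟩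
  (if (M ∷ a) ==ᵛ v then + 1 else + 0) ∎
  where open ≡-Reasoning

map-∸1-injective : ∀ {l l′ : List ℕ} → All (1 ≤_) l → All (1 ≤_) l′ →
                   List.map (_∸ 1) l ≡ List.map (_∸ 1) l′ → l ≡ l′
map-∸1-injective [] [] _ = refl
map-∸1-injective [] (_ ∷ _) ()
map-∸1-injective (_ ∷ _) [] ()
map-∸1-injective (s≤s _ ∷ ps) (s≤s _ ∷ ps′) eq =
  cong₂ _∷_ (cong suc (Listₚ.∷-injectiveˡ eq)) (map-∸1-injective ps ps′ (Listₚ.∷-injectiveʳ eq))

map-∸1-≡⇔ : ∀ {l l′ : List ℕ} → All (1 ≤_) l → All (1 ≤_) l′ →
            (List.map (_∸ 1) l ≡ List.map (_∸ 1) l′) ⇔ (l ≡ l′)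
map-∸1-≡⇔ ps ps′ = mk⇔ (map-∸1-injective ps ps′) (cong (List.map (_∸ 1)))

vecMap-∸1-≡⇔ : ∀ {n} {u u′ : Vec ℕ n} → All (1 ≤_) (Vec.toList u) → All (1 ≤_) (Vec.toList u′) →
               (Vec.map (_∸ 1) u ≡ Vec.map (_∸ 1) u′) ⇔ (Vec.toList u ≡ Vec.toList u′)
vecMap-∸1-≡⇔ {u = u} {u′} ps ps′ = mk⇔
  (λ eq → map-∸1-injective ps ps′
            (trans (sym (Vecₚ.toList-map (_∸ 1) u)) (trans (cong Vec.toList eq) (Vecₚ.toList-map (_∸ 1) u′))))
  (λ eq → cong (Vec.map (_∸ 1)) (toList-injective u u′ eq))

removePair⁺ : ∀ {k} {P : ℕ → Set} (j : Fin k) {u} → All P (Vec.toList u) → All P (removePair j u)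
removePair⁺ zero {_ ∷ _ ∷ _} (_ ∷ _ ∷ ps) = ps
removePair⁺ (suc j) {_ ∷ _} (p ∷ ps) = p ∷ removePair⁺ j ps

dropAt⁺ : ∀ {k} {P : ℕ → Set} (j : Fin k) {a} → All P (Vec.toList a) → All P (dropAt j a)
dropAt⁺ j ps = Allₚ.++⁺ (Allₚ.take⁺ (toℕ j) ps) (Allₚ.drop⁺ (suc (toℕ j)) ps)

δ-combine : ∀ {P : Set} (p? : Dec P) (σ X Y B : ℤ) → (P → X + σ * Y ≡ B) →
            (if ⌊ p? ⌋ then X else + 0) + σ * (if ⌊ p? ⌋ then Y else + 0) ≡ (if ⌊ p? ⌋ then + 1 else + 0) * B
δ-combine (yes p) σ X Y B X+σY≡B = trans (X+σY≡B p) (sym (ℤₚ.*-identityˡ B))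
δ-combine (no _) σ X Y B _ = trans (ℤₚ.+-identityˡ (σ * + 0)) (trans (ℤₚ.*-zeroʳ σ) (sym (ℤₚ.*-zeroˡ B)))

ℤsum-tabulate-+-* : ∀ {n} (σ : ℤ) (f g h : Fin n → ℤ) → (∀ j → f j + σ * g j ≡ h j) →
                    ℤsum (List.tabulate f) + σ * ℤsum (List.tabulate g) ≡ ℤsum (List.tabulate h)
ℤsum-tabulate-+-* {zero} σ f g h _ = trans (ℤₚ.+-identityˡ (σ * + 0)) (ℤₚ.*-zeroʳ σ)
ℤsum-tabulate-+-* {suc n} σ f g h fgh = begin
  f zero + F + σ * (g zero + G)
    ≡⟨ interchange (f zero) F σ (g zero) G ⟩
  (f zero + σ * g zero) + (F + σ * G)
    ≡⟨ cong₂ _+_ (fgh zero) (ℤsum-tabulate-+-* σ (f ∘ suc) (g ∘ suc) (h ∘ suc) (fgh ∘ suc)) ⟩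
  h zero + ℤsum (List.tabulate (h ∘ suc)) ∎
  where
  open ≡-Reasoning
  F = ℤsum (List.tabulate (f ∘ suc))
  G = ℤsum (List.tabulate (g ∘ suc))
  interchange : ∀ x y s a c → x + y + s * (a + c) ≡ (x + s * a) + (y + s * c)
  interchange = solve 5 (λ x y s a c → x :+ y :+ s :* (a :+ c) := (x :+ s :* a) :+ (y :+ s :* c)) refl
    where open +-*-Solver

∸1-+-∸1 : ∀ {x y u w} → 1 ≤ x → 1 ≤ y → 1 ≤ u → 1 ≤ w →
          x ℕ.+ y ≡ u ℕ.+ w → (x ∸ 1) ℕ.+ (y ∸ 1) ≡ (w ∸ 1) ℕ.+ (u ∸ 1)
∸1-+-∸1 {suc x} {suc y} {suc u} {suc w} _ _ _ _ eq =
  trans (ℕₚ.suc-injective (trans (sym (ℕₚ.+-suc x y)) (trans (ℕₚ.suc-injective eq) (ℕₚ.+-suc u w)))) (ℕₚ.+-comm u w)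

adjacent-sum : ∀ {s} m (ms : Vec ℕ s) ns (j : Fin s) → sum ns ≡ m ℕ.+ sum ms → dropAt j ms ≡ removePair j ns →
               m ℕ.+ lookup ms j ≡ lookup ns (inject₁ j) ℕ.+ lookup ns (suc j)
adjacent-sum m ms ns j Σns≡m+Σms rest≡ = ℕₚ.+-cancelʳ-≡ S (m ℕ.+ lookup ms j) _ (begin
  m ℕ.+ lookup ms j ℕ.+ S                          ≡⟨ ℕₚ.+-assoc m (lookup ms j) S ⟩
  m ℕ.+ (lookup ms j ℕ.+ S)                        ≡⟨ cong (λ l → m ℕ.+ (lookup ms j ℕ.+ ℕᴸ.sum l)) (sym rest≡) ⟩
  m ℕ.+ (lookup ms j ℕ.+ ℕᴸ.sum (dropAt j ms))     ≡⟨ cong (m ℕ.+_) (sym (sum-dropAt j ms)) ⟩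
  m ℕ.+ sum ms                                     ≡⟨ sym Σns≡m+Σms ⟩
  sum ns                                           ≡⟨ sum-removePair j ns ⟩
  lookup ns (inject₁ j) ℕ.+ lookup ns (suc j) ℕ.+ S ∎)
  where
  open ≡-Reasoning
  S = ℕᴸ.sum (removePair j ns)

adjacent-pair : ∀ {s} m (ms : Vec ℕ s) ns (j : Fin s) →
  1 ≤ m → (∀ i → 1 ≤ lookup ms i) → (∀ i → 1 ≤ lookup ns i) → sum ns ≡ m ℕ.+ sum ms →
  coeff (((var (suc j) ⊖ var (inject₁ j)) ^P (m ∸ 1)) ⊗ omit (suc j) (monomial (Vec.map (_∸ 1) ms))) (Vec.map (_∸ 1) ns)
  + neg1^ m * coeff (((var (inject₁ j) ⊖ var (suc j)) ^P (m ∸ 1)) ⊗ omit (inject₁ j) (monomial (Vec.map (_∸ 1) ms)))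
                    (Vec.map (_∸ 1) ns)
  ≡ δ (dropAt j ms) (take (toℕ j) (Vec.toList ns) ++ drop (suc (suc (toℕ j))) (Vec.toList ns))
    * b m (lookup ns (inject₁ j)) (lookup ns (suc j))
adjacent-pair m ms ns j m≥1 ms≥1 ns≥1 Σns≡m+Σms = begin
  _ ≡⟨ cong₂ (λ x y → x + neg1^ m * y) (coeff-rising-⊗-omit (m ∸ 1) j a v) (coeff-falling-⊗-omit (m ∸ 1) j a v) ⟩
  (if agree then X else + 0) + neg1^ m * (if agree then Y else + 0)
    ≡⟨ cong (λ t → (if t then X else + 0) + neg1^ m * (if t then Y else + 0)) agree≡ ⟩
  (if ⌊ rest? ⌋ then X else + 0) + neg1^ m * (if ⌊ rest? ⌋ then Y else + 0)
    ≡⟨ δ-combine rest? (neg1^ m) X Y B X+σY≡b ⟩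
  δ (dropAt j ms) (removePair j ns) * B
    ≡⟨ cong (λ l → δ (dropAt j ms) l * B) (removePair-toList j ns) ⟩
  δ (dropAt j ms) (take (toℕ j) (Vec.toList ns) ++ drop (suc (suc (toℕ j))) (Vec.toList ns)) * B ∎
  where
  open ≡-Reasoning
  a = Vec.map (_∸ 1) ms
  v = Vec.map (_∸ 1) ns
  X = atMinus (lookup v (inject₁ j)) (lookup a j) (diffPowCoeff (m ∸ 1) (lookup v (suc j)))
  Y = atMinus (lookup v (suc j)) (lookup a j) (diffPowCoeff (m ∸ 1) (lookup v (inject₁ j)))
  B = b m (lookup ns (inject₁ j)) (lookup ns (suc j))
  agree = ⌊ Listₚ.≡-dec ℕ._≟_ (dropAt j a) (removePair j v) ⌋
  rest? = Listₚ.≡-dec ℕ._≟_ (dropAt j ms) (removePair j ns)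

  agree≡ : agree ≡ ⌊ rest? ⌋
  agree≡ = trans (cong₂ (λ l l′ → ⌊ Listₚ.≡-dec ℕ._≟_ l l′ ⌋)
                        (dropAt-map (_∸ 1) j ms) (removePair-map (_∸ 1) j ns))
                 (⌊⌋-⇔ (map-∸1-≡⇔ (dropAt⁺ j (VecAllₚ.toList⁺ (VecAllₚ.lookup⁻ ms≥1)))
                                  (removePair⁺ j (VecAllₚ.toList⁺ (VecAllₚ.lookup⁻ ns≥1))))
                       (Listₚ.≡-dec ℕ._≟_ _ _) rest?)

  X+σY≡b : dropAt j ms ≡ removePair j ns → X + neg1^ m * Y ≡ B
  X+σY≡b rest≡
    rewrite Vecₚ.lookup-map (inject₁ j) (_∸ 1) ns | Vecₚ.lookup-map (suc j) (_∸ 1) ns | Vecₚ.lookup-map j (_∸ 1) ms =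
    b≡atMinus-diffPowCoeff (lookup ms j ∸ 1) m≥1 (ns≥1 (inject₁ j)) (ns≥1 (suc j))
      (∸1-+-∸1 m≥1 (ms≥1 j) (ns≥1 (inject₁ j)) (ns≥1 (suc j)) (adjacent-sum m ms ns j Σns≡m+Σms rest≡))

coeff-leading-term : ∀ {s} m (ms : Vec ℕ s) ns → (∀ i → 1 ≤ lookup (m ∷ ms) i) → (∀ i → 1 ≤ lookup ns i) →
  coeff ((var zero ^P (m ∸ 1)) ⊗ omit zero (monomial (Vec.map (_∸ 1) ms))) (Vec.map (_∸ 1) ns)
    ≡ δ (Vec.toList (m ∷ ms)) (Vec.toList ns)
coeff-leading-term m ms ns ms≥1 ns≥1 =
  trans (coeff-x₁^-⊗-omit-zero (m ∸ 1) (Vec.map (_∸ 1) ms) (Vec.map (_∸ 1) ns))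
        (cong (λ t → if t then + 1 else + 0)
              (⌊⌋-⇔ (vecMap-∸1-≡⇔ (VecAllₚ.toList⁺ (VecAllₚ.lookup⁻ ms≥1))
                                  (VecAllₚ.toList⁺ (VecAllₚ.lookup⁻ ns≥1)))
                    (Vecₚ.≡-dec ℕ._≟_ _ _) (Listₚ.≡-dec ℕ._≟_ _ _)))

lemma3p1 : (k : ℕ) (ms ns : Vec ℕ (suc k)) →
           (∀ i → 1 ≤ lookup ms i) → (∀ i → 1 ≤ lookup ns i) →
           sum ns ≡ sum ms →
           e ms ns ≡ rhs ms ns
lemma3p1 zero (m ∷ []) (n ∷ []) _ _ _ = sym (ℤₚ.+-identityʳ _)
lemma3p1 (suc s) (m ∷ ms) ns ms≥1 ns≥1 Σns≡Σms = begin
  e (m ∷ ms) ns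
    ≡⟨ coeff-circ m (monomial a) v ⟩
  coeff F₀ v + ℤsum (List.tabulate F) + σ * ℤsum (List.tabulate G)
    ≡⟨ ℤₚ.+-assoc (coeff F₀ v) _ _ ⟩
  coeff F₀ v + (ℤsum (List.tabulate F) + σ * ℤsum (List.tabulate G))
    ≡⟨ cong₂ _+_ (coeff-leading-term m ms ns ms≥1 ns≥1)
                 (ℤsum-tabulate-+-* σ F G H (λ j → adjacent-pair m ms ns j (ms≥1 zero) (ms≥1 ∘ suc) ns≥1 Σns≡Σms)) ⟩
  δ (Vec.toList (m ∷ ms)) (Vec.toList ns) + ℤsum (List.tabulate H)
    ≡⟨ cong (λ l → δ (Vec.toList (m ∷ ms)) (Vec.toList ns) + ℤsum l) (sym (Listₚ.map-tabulate (λ j → j) H)) ⟩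
  rhs (m ∷ ms) ns ∎
  where
  open ≡-Reasoning
  a = Vec.map (_∸ 1) ms
  v = Vec.map (_∸ 1) ns
  σ = neg1^ m
  F₀ = (var zero ^P (m ∸ 1)) ⊗ omit zero (monomial a)
  F G H : Fin (suc s) → ℤ
  F j = coeff (((var (suc j) ⊖ var (inject₁ j)) ^P (m ∸ 1)) ⊗ omit (suc j) (monomial a)) v
  G j = coeff (((var (inject₁ j) ⊖ var (suc j)) ^P (m ∸ 1)) ⊗ omit (inject₁ j) (monomial a)) v
  H j = δ (dropAt j ms) (take (toℕ j) (Vec.toList ns) ++ drop (suc (suc (toℕ j))) (Vec.toList ns))
        * b m (lookup ns (inject₁ j)) (lookup ns (suc j))
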